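{- For $m\in\mathbb{N}$ with $m\equiv1\pmod 2$ and $n\in\mathbb{N}\cup\{0\}$, \[ 2^{n-1}\bigl(E_n(m)+E_n\bigr)=\sum_{l=0}^{m-1}(-1)^l(2l+1)^n. \]
   Context: The type 2 Euler polynomials $E_n(x)$ are defined by $\frac{2}{e^{t/2}+e^{ -t/2}}e^{xt}=\sum_{n\ge0}E_n(x)\frac{t^n}{n!}$, and $E_n=E_n(0)$. -}

module Defs where

open import Data.Nat as ℕ using (ℕ; zero; suc)
open import Data.Integer using (+_)
open import Data.Rational using (ℚ; 0ℚ; 1ℚ; ½; -½; _+_; _*_; _-_; -_; _/_)
open import Data.Fin using (Fin; toℕ)
open import Data.Vec using (Vec; []; _∷_; _∷ʳ_; lookup; tabulate; foldr′; last)
open import Data.Nat.Combinatorics using (_C_)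

⟦_⟧ : ℕ → ℚ
⟦ n ⟧ = + n / 1

infixr 8 _^ℚ_
_^ℚ_ : ℚ → ℕ → ℚ
q ^ℚ zero = 1ℚ
q ^ℚ suc n = q * (q ^ℚ n)

Σ< : ℕ → (ℕ → ℚ) → ℚ
Σ< zero f = 0ℚ
Σ< (suc n) f = Σ< n f + f n

Σvec : ∀ {n} → (ℕ → ℚ → ℚ) → Vec ℚ n → ℚ
Σvec g v = foldr′ _+_ 0ℚ (tabulate (λ i → g (toℕ i) (lookup v i)))

-- Coefficient c_j of t^j/j! in e^{t/2}+e^{-t/2}: (1/2)^j + (-1/2)^j
c : ℕ → ℚ
c j = (½ ^ℚ j) + (-½ ^ℚ j)

-- table n x = [E_0(x), ..., E_n(x)], obtained by comparing coefficients of
-- t^n/n! in (e^{t/2}+e^{-t/2}) · Σ E_k(x) t^k/k! = 2 e^{xt}, i.e.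
--   Σ_{k=0}^{n} C(n,k) E_k(x) c_{n-k} = 2 x^n,  with c_0 = 2.
eulerTable : (n : ℕ) → ℚ → Vec ℚ (suc n)
eulerTable zero x = 1ℚ ∷ []
eulerTable (suc n) x =
  eulerTable n x ∷ʳ
    ((x ^ℚ suc n) - (½ * Σvec (λ k e → ⟦ suc n C k ⟧ * e * c (suc n ℕ.∸ k)) (eulerTable n x)))

E : ℕ → ℚ → ℚ
E n x = last (eulerTable n x)

Enum : ℕ → ℚ
Enum n = E n 0ℚ

{-# OPTIONS --safe #-}
-- Comparing coefficients of t^N/N! in the generating function, the sequence E_N(x) is
-- the unique one whose binomial convolution with the coefficients c_j of e^{t/2}+e^{-t/2}
-- is 2 x^N; uniqueness holds because the convolution is triangular with diagonal c_0 = 2.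
-- Since (e^{t/2}+e^{-t/2}) e^{(x+1/2)t} = e^{(x+1)t} + e^{xt}, the sequence 2 (x+1/2)^N has the
-- same convolution as E_N(x+1) + E_N(x), whence 2^{n-1} (E_n(l+1) + E_n(l)) = (2l+1)^n.
-- Summing over l < m with signs (-1)^l telescopes to E_n(m) + E_n(0) when m is odd.
module Submission where

open import Level using (0ℓ)
open import Function using (_∘_)
open import Algebra.Bundles using (CommutativeRing)
open import Data.Nat as ℕ using (ℕ; zero; suc; _∸_; _<_; _%_)
open import Data.Nat.Properties using (n∸n≡0; ≤-refl; m<n⇒m<1+n)
open import Data.Nat.Combinatorics using (_C_; nCn≡1)
open import Data.Nat.Induction using (<-rec)
import Data.Integer as ℤ
import Data.Integer.Properties as ℤ
open import Data.Rational using (ℚ; 0ℚ; 1ℚ; ½; -½; _+_; _*_; _-_; -_; toℚᵘ)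
open import Data.Rational.Properties
  using ( _≟_; +-*-commutativeRing; +-0-group; toℚᵘ-injective; toℚᵘ-fromℚᵘ; toℚᵘ-homo-+; toℚᵘ-homo-*
        ; +-comm; +-assoc; +-inverseʳ; *-comm; *-identityˡ; *-zeroˡ; *-zeroʳ; *-distribˡ-+; *-distribʳ-+)
import Data.Rational.Unnormalised as ℚᵘ
import Data.Rational.Unnormalised.Properties as ℚᵘ
open import Data.Fin using (toℕ)
open import Data.Vec using (Vec; []; _∷_; _∷ʳ_)
open import Data.Vec.Properties using (last-∷ʳ)
open import Relation.Nullary.Decidable using (dec⇒maybe)
open import Relation.Binary.PropositionalEquality
  using (_≡_; refl; sym; trans; cong; cong₂; module ≡-Reasoning)
open import Tactic.RingSolver using (solve-∀)
open import Tactic.RingSolver.Core.AlmostCommutativeRing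
  using (AlmostCommutativeRing; fromCommutativeRing)

open import Defs

open CommutativeRing +-*-commutativeRing using (commutativeSemiring; semiring; *-commutativeSemigroup)
open import Algebra.Properties.Group +-0-group using (∙-cancelˡ)
open import Algebra.Properties.CommutativeSemigroup *-commutativeSemigroup using (x∙yz≈y∙xz)
open import Algebra.Properties.Semiring.Mult semiring using (_×_)
open import Algebra.Properties.Semiring.Sum semiring using (sum)
open import Algebra.Properties.CommutativeSemiring.Exp commutativeSemiring using (_^_; ^-distrib-*)
open import Algebra.Properties.CommutativeSemiring.Binomial commutativeSemiring using (theorem)

ℚ-ring : AlmostCommutativeRing 0ℓ 0ℓ
ℚ-ring = fromCommutativeRing +-*-commutativeRing (λ q → dec⇒maybe (0ℚ ≟ q))

toℚᵘ-⟦⟧ : ∀ n → toℚᵘ ⟦ n ⟧ ℚᵘ.≃ ℚᵘ.mkℚᵘ (ℤ.+ n) 0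
toℚᵘ-⟦⟧ n = toℚᵘ-fromℚᵘ (ℚᵘ.mkℚᵘ (ℤ.+ n) 0)

⟦⟧-homo-+ : ∀ m n → ⟦ m ℕ.+ n ⟧ ≡ ⟦ m ⟧ + ⟦ n ⟧
⟦⟧-homo-+ m n = toℚᵘ-injective (begin
  toℚᵘ ⟦ m ℕ.+ n ⟧                        ≈⟨ toℚᵘ-⟦⟧ (m ℕ.+ n) ⟩
  ℚᵘ.mkℚᵘ (ℤ.+ (m ℕ.+ n)) 0                ≡⟨ cong (λ i → ℚᵘ.mkℚᵘ i 0) (ℤ.pos-+ m n) ⟩
  ℚᵘ.mkℚᵘ (ℤ.+ m ℤ.+ ℤ.+ n) 0              ≡⟨ cong₂ (λ i j → ℚᵘ.mkℚᵘ (i ℤ.+ j) 0)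
                                                     (ℤ.*-identityʳ (ℤ.+ m)) (ℤ.*-identityʳ (ℤ.+ n)) ⟨
  ℚᵘ.mkℚᵘ (ℤ.+ m) 0 ℚᵘ.+ ℚᵘ.mkℚᵘ (ℤ.+ n) 0 ≈⟨ ℚᵘ.+-cong (toℚᵘ-⟦⟧ m) (toℚᵘ-⟦⟧ n) ⟨
  toℚᵘ ⟦ m ⟧ ℚᵘ.+ toℚᵘ ⟦ n ⟧                ≈⟨ toℚᵘ-homo-+ ⟦ m ⟧ ⟦ n ⟧ ⟨
  toℚᵘ (⟦ m ⟧ + ⟦ n ⟧)                     ∎)
  where open ℚᵘ.≃-Reasoning

⟦⟧-homo-* : ∀ m n → ⟦ m ℕ.* n ⟧ ≡ ⟦ m ⟧ * ⟦ n ⟧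
⟦⟧-homo-* m n = toℚᵘ-injective (begin
  toℚᵘ ⟦ m ℕ.* n ⟧                        ≈⟨ toℚᵘ-⟦⟧ (m ℕ.* n) ⟩
  ℚᵘ.mkℚᵘ (ℤ.+ (m ℕ.* n)) 0                ≡⟨ cong (λ i → ℚᵘ.mkℚᵘ i 0) (ℤ.pos-* m n) ⟩
  ℚᵘ.mkℚᵘ (ℤ.+ m) 0 ℚᵘ.* ℚᵘ.mkℚᵘ (ℤ.+ n) 0 ≈⟨ ℚᵘ.*-cong (toℚᵘ-⟦⟧ m) (toℚᵘ-⟦⟧ n) ⟨
  toℚᵘ ⟦ m ⟧ ℚᵘ.* toℚᵘ ⟦ n ⟧                ≈⟨ toℚᵘ-homo-* ⟦ m ⟧ ⟦ n ⟧ ⟨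
  toℚᵘ (⟦ m ⟧ * ⟦ n ⟧)                     ∎)
  where open ℚᵘ.≃-Reasoning

⟦2l+1⟧ : ∀ l → ⟦ 2 ℕ.* l ℕ.+ 1 ⟧ ≡ ⟦ 2 ⟧ * ⟦ l ⟧ + 1ℚ
⟦2l+1⟧ l = trans (⟦⟧-homo-+ (2 ℕ.* l) 1) (cong (_+ 1ℚ) (⟦⟧-homo-* 2 l))

^≡^ℚ : ∀ q n → q ^ n ≡ q ^ℚ n
^≡^ℚ q zero    = refl
^≡^ℚ q (suc n) = cong (q *_) (^≡^ℚ q n)

^ℚ-distrib-* : ∀ p q n → (p * q) ^ℚ n ≡ p ^ℚ n * q ^ℚ n
^ℚ-distrib-* p q n = begin
  (p * q) ^ℚ n    ≡⟨ ^≡^ℚ (p * q) n ⟨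
  (p * q) ^ n     ≡⟨ ^-distrib-* p q n ⟩
  p ^ n * q ^ n   ≡⟨ cong₂ _*_ (^≡^ℚ p n) (^≡^ℚ q n) ⟩
  p ^ℚ n * q ^ℚ n ∎
  where open ≡-Reasoning

-- m % 2 computes: suc (suc m) % 2 reduces to m % 2, and 0 % 2 ≡ 1 is absurd.
-1^odd : ∀ m → m % 2 ≡ 1 → (- 1ℚ) ^ℚ m ≡ - 1ℚ
-1^odd 1             _     = refl
-1^odd (suc (suc m)) m-odd = cong (λ s → - 1ℚ * (- 1ℚ * s)) (-1^odd m m-odd)

Σ<-cong : ∀ n {f g : ℕ → ℚ} → (∀ k → k < n → f k ≡ g k) → Σ< n f ≡ Σ< n g
Σ<-cong zero    f≗g = refl
Σ<-cong (suc n) f≗g = cong₂ _+_ (Σ<-cong n (λ k k<n → f≗g k (m<n⇒m<1+n k<n))) (f≗g n ≤-refl)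

Σ<-distrib-+ : ∀ n (f g : ℕ → ℚ) → Σ< n (λ k → f k + g k) ≡ Σ< n f + Σ< n g
Σ<-distrib-+ zero    f g = refl
Σ<-distrib-+ (suc n) f g = begin
  Σ< n (λ k → f k + g k) + (f n + g n) ≡⟨ cong (_+ (f n + g n)) (Σ<-distrib-+ n f g) ⟩
  (Σ< n f + Σ< n g) + (f n + g n)     ≡⟨ interchange (Σ< n f) (Σ< n g) (f n) (g n) ⟩
  (Σ< n f + f n) + (Σ< n g + g n)     ∎
  where
  open ≡-Reasoning
  interchange : ∀ a b c d → (a + b) + (c + d) ≡ (a + c) + (b + d)
  interchange = solve-∀ ℚ-ring

*-distribˡ-Σ< : ∀ n a (f : ℕ → ℚ) → a * Σ< n f ≡ Σ< n (λ k → a * f k)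
*-distribˡ-Σ< zero    a f = *-zeroʳ a
*-distribˡ-Σ< (suc n) a f =
  trans (*-distribˡ-+ a (Σ< n f) (f n)) (cong (_+ a * f n) (*-distribˡ-Σ< n a f))

Σ<-suc : ∀ n (f : ℕ → ℚ) → Σ< (suc n) f ≡ f 0 + Σ< n (f ∘ suc)
Σ<-suc zero    f = +-comm 0ℚ (f 0)
Σ<-suc (suc n) f = trans (cong (_+ f (suc n)) (Σ<-suc n f)) (+-assoc (f 0) _ _)

sum≡Σ< : ∀ n (f : ℕ → ℚ) → sum {n} (f ∘ toℕ) ≡ Σ< n f
sum≡Σ< zero    f = refl
sum≡Σ< (suc n) f = trans (cong (f 0 +_) (sum≡Σ< n (f ∘ suc))) (sym (Σ<-suc n f))

Σ<-alternating-telescope : ∀ (a : ℕ → ℚ) m →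
  Σ< m (λ l → (- 1ℚ) ^ℚ l * (a (suc l) + a l)) ≡ a 0 - (- 1ℚ) ^ℚ m * a m
Σ<-alternating-telescope a zero    =
  sym (trans (cong (λ x → a 0 - x) (*-identityˡ (a 0))) (+-inverseʳ (a 0)))
Σ<-alternating-telescope a (suc m) = begin
  Σ< m (λ l → (- 1ℚ) ^ℚ l * (a (suc l) + a l)) + s * (a (suc m) + a m)
    ≡⟨ cong (_+ s * (a (suc m) + a m)) (Σ<-alternating-telescope a m) ⟩
  a 0 - s * a m + s * (a (suc m) + a m)
    ≡⟨ telescope (a 0) s (a m) (a (suc m)) ⟩
  a 0 - (- 1ℚ) * s * a (suc m)
    ∎
  where
  open ≡-Reasoning
  s : ℚ
  s = (- 1ℚ) ^ℚ m
  telescope : ∀ a₀ s x y → a₀ - s * x + s * (y + x) ≡ a₀ - (- 1ℚ) * s * y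
  telescope = solve-∀ ℚ-ring

Σ<-alternating-telescope-odd : ∀ (a : ℕ → ℚ) m → m % 2 ≡ 1 →
  Σ< m (λ l → (- 1ℚ) ^ℚ l * (a (suc l) + a l)) ≡ a m + a 0
Σ<-alternating-telescope-odd a m m-odd = begin
  Σ< m (λ l → (- 1ℚ) ^ℚ l * (a (suc l) + a l)) ≡⟨ Σ<-alternating-telescope a m ⟩
  a 0 - (- 1ℚ) ^ℚ m * a m                       ≡⟨ cong (λ s → a 0 - s * a m) (-1^odd m m-odd) ⟩
  a 0 - (- 1ℚ) * a m                            ≡⟨ flip (a 0) (a m) ⟩
  a m + a 0                                     ∎
  where
  open ≡-Reasoning
  flip : ∀ x y → x - (- 1ℚ) * y ≡ y + x
  flip = solve-∀ ℚ-ring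

×≡⟦⟧* : ∀ n q → n × q ≡ ⟦ n ⟧ * q
×≡⟦⟧* zero    q = sym (*-zeroˡ q)
×≡⟦⟧* (suc n) q = begin
  q + n × q          ≡⟨ cong (q +_) (×≡⟦⟧* n q) ⟩
  q + ⟦ n ⟧ * q      ≡⟨ cong (_+ ⟦ n ⟧ * q) (*-identityˡ q) ⟨
  1ℚ * q + ⟦ n ⟧ * q ≡⟨ *-distribʳ-+ q 1ℚ ⟦ n ⟧ ⟨
  (1ℚ + ⟦ n ⟧) * q   ≡⟨ cong (_* q) (⟦⟧-homo-+ 1 n) ⟨
  ⟦ suc n ⟧ * q      ∎
  where open ≡-Reasoning

binomial : ∀ N a b → (a + b) ^ℚ N ≡ Σ< (suc N) (λ k → ⟦ N C k ⟧ * (a ^ℚ k * b ^ℚ (N ∸ k)))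
binomial N a b = begin
  (a + b) ^ℚ N                                                ≡⟨ ^≡^ℚ (a + b) N ⟨
  (a + b) ^ N                                                 ≡⟨ theorem N a b ⟩
  sum {suc N} ((λ k → (N C k) × (a ^ k * b ^ (N ∸ k))) ∘ toℕ) ≡⟨ sum≡Σ< (suc N) _ ⟩
  Σ< (suc N) (λ k → (N C k) × (a ^ k * b ^ (N ∸ k)))          ≡⟨ Σ<-cong (suc N) (λ k _ → term k) ⟩
  Σ< (suc N) (λ k → ⟦ N C k ⟧ * (a ^ℚ k * b ^ℚ (N ∸ k)))      ∎
  where
  open ≡-Reasoning
  term : ∀ k → (N C k) × (a ^ k * b ^ (N ∸ k)) ≡ ⟦ N C k ⟧ * (a ^ℚ k * b ^ℚ (N ∸ k))
  term k = trans (×≡⟦⟧* (N C k) _) (cong₂ (λ u v → ⟦ N C k ⟧ * (u * v)) (^≡^ℚ a k) (^≡^ℚ b (N ∸ k)))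

Σvec-∷ʳ : ∀ {n} (g : ℕ → ℚ → ℚ) (xs : Vec ℚ n) a → Σvec g (xs ∷ʳ a) ≡ Σvec g xs + g n a
Σvec-∷ʳ g []       a = +-comm (g 0 a) 0ℚ
Σvec-∷ʳ g (y ∷ ys) a =
  trans (cong (g 0 y +_) (Σvec-∷ʳ (g ∘ suc) ys a)) (sym (+-assoc (g 0 y) _ _))

Σvec-eulerTable : ∀ n x (g : ℕ → ℚ → ℚ) → Σvec g (eulerTable n x) ≡ Σ< (suc n) (λ k → g k (E k x))
Σvec-eulerTable zero    x g = +-comm (g 0 1ℚ) 0ℚ
Σvec-eulerTable (suc n) x g = trans (Σvec-∷ʳ g (eulerTable n x) _)
  (cong₂ _+_ (Σvec-eulerTable n x g) (cong (g (suc n)) (sym (last-∷ʳ _ (eulerTable n x)))))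

E-suc : ∀ n x →
  E (suc n) x ≡ x ^ℚ suc n - ½ * Σ< (suc n) (λ k → ⟦ suc n C k ⟧ * E k x * c (suc n ∸ k))
E-suc n x = trans (last-∷ʳ _ (eulerTable n x))
  (cong (λ s → x ^ℚ suc n - ½ * s)
        (Σvec-eulerTable n x (λ k e → ⟦ suc n C k ⟧ * e * c (suc n ∸ k))))

-- The coefficient of t^N/N! in (e^{t/2}+e^{-t/2}) · Σ_k F k t^k/k!.
cConv : (ℕ → ℚ) → ℕ → ℚ
cConv F N = Σ< (suc N) (λ k → ⟦ N C k ⟧ * F k * c (N ∸ k))

cConv-split : ∀ F N → cConv F N ≡ Σ< N (λ k → ⟦ N C k ⟧ * F k * c (N ∸ k)) + ⟦ 2 ⟧ * F N
cConv-split F N = cong (Σ< N (λ k → ⟦ N C k ⟧ * F k * c (N ∸ k)) +_) (begin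
  ⟦ N C N ⟧ * F N * c (N ∸ N) ≡⟨ cong₂ (λ i j → ⟦ i ⟧ * F N * c j) (nCn≡1 N) (n∸n≡0 N) ⟩
  1ℚ * F N * ⟦ 2 ⟧            ≡⟨ cong (_* ⟦ 2 ⟧) (*-identityˡ (F N)) ⟩
  F N * ⟦ 2 ⟧                 ≡⟨ *-comm (F N) ⟦ 2 ⟧ ⟩
  ⟦ 2 ⟧ * F N                 ∎)
  where open ≡-Reasoning

cConv-E : ∀ x N → cConv (λ k → E k x) N ≡ ⟦ 2 ⟧ * x ^ℚ N
cConv-E x zero    = refl
cConv-E x (suc n) = begin
  cConv (λ k → E k x) (suc n)             ≡⟨ cConv-split (λ k → E k x) (suc n) ⟩
  S + ⟦ 2 ⟧ * E (suc n) x                 ≡⟨ cong (λ e → S + ⟦ 2 ⟧ * e) (E-suc n x) ⟩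
  S + ⟦ 2 ⟧ * (x ^ℚ suc n - ½ * S)        ≡⟨ cancel S (x ^ℚ suc n) ⟩
  ⟦ 2 ⟧ * x ^ℚ suc n                      ∎
  where
  open ≡-Reasoning
  S : ℚ
  S = Σ< (suc n) (λ k → ⟦ suc n C k ⟧ * E k x * c (suc n ∸ k))
  cancel : ∀ s y → s + ⟦ 2 ⟧ * (y - ½ * s) ≡ ⟦ 2 ⟧ * y
  cancel = solve-∀ ℚ-ring

cConv-injective : ∀ {F G} → (∀ N → cConv F N ≡ cConv G N) → ∀ N → F N ≡ G N
cConv-injective {F} {G} same-cConv = <-rec _ step
  where
  below : (ℕ → ℚ) → ℕ → ℚ
  below H N = Σ< N (λ k → ⟦ N C k ⟧ * H k * c (N ∸ k))
  halve : ∀ p → ½ * (⟦ 2 ⟧ * p) ≡ p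
  halve = solve-∀ ℚ-ring
  step : ∀ N → (∀ {k} → k < N → F k ≡ G k) → F N ≡ G N
  step N same-below = begin
    F N               ≡⟨ halve (F N) ⟨
    ½ * (⟦ 2 ⟧ * F N) ≡⟨ cong (½ *_) same-top ⟩
    ½ * (⟦ 2 ⟧ * G N) ≡⟨ halve (G N) ⟩
    G N               ∎
    where
    open ≡-Reasoning
    same-lower : below F N ≡ below G N
    same-lower = Σ<-cong N (λ k k<N → cong (λ v → ⟦ N C k ⟧ * v * c (N ∸ k)) (same-below k<N))
    same-top : ⟦ 2 ⟧ * F N ≡ ⟦ 2 ⟧ * G N
    same-top = ∙-cancelˡ (below G N) _ _ (begin
      below G N + ⟦ 2 ⟧ * F N ≡⟨ cong (_+ ⟦ 2 ⟧ * F N) same-lower ⟨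
      below F N + ⟦ 2 ⟧ * F N ≡⟨ cConv-split F N ⟨
      cConv F N               ≡⟨ same-cConv N ⟩
      cConv G N               ≡⟨ cConv-split G N ⟩
      below G N + ⟦ 2 ⟧ * G N ∎)

cConv-+ : ∀ F G N → cConv (λ k → F k + G k) N ≡ cConv F N + cConv G N
cConv-+ F G N = trans (Σ<-cong (suc N) (λ k _ → distrib ⟦ N C k ⟧ (F k) (G k) (c (N ∸ k))))
                      (Σ<-distrib-+ (suc N) _ _)
  where
  distrib : ∀ b u v w → b * (u + v) * w ≡ b * u * w + b * v * w
  distrib = solve-∀ ℚ-ring

cConv-*ˡ : ∀ a F N → cConv (λ k → a * F k) N ≡ a * cConv F N
cConv-*ˡ a F N = trans (Σ<-cong (suc N) (λ k _ → pull ⟦ N C k ⟧ a (F k) (c (N ∸ k))))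
                       (sym (*-distribˡ-Σ< (suc N) a _))
  where
  pull : ∀ b a u w → b * (a * u) * w ≡ a * (b * u * w)
  pull = solve-∀ ℚ-ring

cConv-pow : ∀ a N → cConv (a ^ℚ_) N ≡ (a + ½) ^ℚ N + (a - ½) ^ℚ N
cConv-pow a N = begin
  cConv (a ^ℚ_) N
    ≡⟨ Σ<-cong (suc N) (λ k _ → split ⟦ N C k ⟧ (a ^ℚ k) (½ ^ℚ (N ∸ k)) (-½ ^ℚ (N ∸ k))) ⟩
  Σ< (suc N) (λ k → ⟦ N C k ⟧ * (a ^ℚ k * ½ ^ℚ (N ∸ k)) + ⟦ N C k ⟧ * (a ^ℚ k * -½ ^ℚ (N ∸ k)))
    ≡⟨ Σ<-distrib-+ (suc N) _ _ ⟩
  Σ< (suc N) (λ k → ⟦ N C k ⟧ * (a ^ℚ k * ½ ^ℚ (N ∸ k)))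
    + Σ< (suc N) (λ k → ⟦ N C k ⟧ * (a ^ℚ k * -½ ^ℚ (N ∸ k)))
    ≡⟨ cong₂ _+_ (binomial N a ½) (binomial N a -½) ⟨
  (a + ½) ^ℚ N + (a - ½) ^ℚ N
    ∎
  where
  open ≡-Reasoning
  split : ∀ b u p q → b * u * (p + q) ≡ b * (u * p) + b * (u * q)
  split = solve-∀ ℚ-ring

E-shift : ∀ N x → E N (1ℚ + x) + E N x ≡ ⟦ 2 ⟧ * (x + ½) ^ℚ N
E-shift N x = cConv-injective (λ M → begin
  cConv (λ k → E k (1ℚ + x) + E k x) M
    ≡⟨ cConv-+ _ _ M ⟩
  cConv (λ k → E k (1ℚ + x)) M + cConv (λ k → E k x) M
    ≡⟨ cong₂ _+_ (cConv-E (1ℚ + x) M) (cConv-E x M) ⟩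
  ⟦ 2 ⟧ * (1ℚ + x) ^ℚ M + ⟦ 2 ⟧ * x ^ℚ M
    ≡⟨ cong₂ (λ u v → ⟦ 2 ⟧ * u ^ℚ M + ⟦ 2 ⟧ * v ^ℚ M) (up x) (down x) ⟩
  ⟦ 2 ⟧ * (x + ½ + ½) ^ℚ M + ⟦ 2 ⟧ * (x + ½ - ½) ^ℚ M
    ≡⟨ *-distribˡ-+ ⟦ 2 ⟧ ((x + ½ + ½) ^ℚ M) ((x + ½ - ½) ^ℚ M) ⟨
  ⟦ 2 ⟧ * ((x + ½ + ½) ^ℚ M + (x + ½ - ½) ^ℚ M)
    ≡⟨ cong (⟦ 2 ⟧ *_) (cConv-pow (x + ½) M) ⟨
  ⟦ 2 ⟧ * cConv ((x + ½) ^ℚ_) M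
    ≡⟨ cConv-*ˡ ⟦ 2 ⟧ _ M ⟨
  cConv (λ k → ⟦ 2 ⟧ * (x + ½) ^ℚ k) M
    ∎) N
  where
  open ≡-Reasoning
  up : ∀ x → 1ℚ + x ≡ x + ½ + ½
  up = solve-∀ ℚ-ring
  down : ∀ x → x ≡ x + ½ - ½
  down = solve-∀ ℚ-ring

E-shift-ℕ : ∀ n l → (½ * ⟦ 2 ⟧ ^ℚ n) * (E n ⟦ suc l ⟧ + E n ⟦ l ⟧) ≡ ⟦ 2 ℕ.* l ℕ.+ 1 ⟧ ^ℚ n
E-shift-ℕ n l = begin
  K * (E n ⟦ suc l ⟧ + E n ⟦ l ⟧)        ≡⟨ cong (λ y → K * (E n y + E n ⟦ l ⟧)) (⟦⟧-homo-+ 1 l) ⟩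
  K * (E n (1ℚ + ⟦ l ⟧) + E n ⟦ l ⟧)     ≡⟨ cong (K *_) (E-shift n ⟦ l ⟧) ⟩
  K * (⟦ 2 ⟧ * (⟦ l ⟧ + ½) ^ℚ n)         ≡⟨ halve-double (⟦ 2 ⟧ ^ℚ n) _ ⟩
  ⟦ 2 ⟧ ^ℚ n * (⟦ l ⟧ + ½) ^ℚ n          ≡⟨ ^ℚ-distrib-* ⟦ 2 ⟧ (⟦ l ⟧ + ½) n ⟨
  (⟦ 2 ⟧ * (⟦ l ⟧ + ½)) ^ℚ n             ≡⟨ cong (_^ℚ n) (double ⟦ l ⟧) ⟩
  (⟦ 2 ⟧ * ⟦ l ⟧ + 1ℚ) ^ℚ n              ≡⟨ cong (_^ℚ n) (⟦2l+1⟧ l) ⟨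
  ⟦ 2 ℕ.* l ℕ.+ 1 ⟧ ^ℚ n                 ∎
  where
  open ≡-Reasoning
  K : ℚ
  K = ½ * ⟦ 2 ⟧ ^ℚ n
  halve-double : ∀ p q → (½ * p) * (⟦ 2 ⟧ * q) ≡ p * q
  halve-double = solve-∀ ℚ-ring
  double : ∀ y → ⟦ 2 ⟧ * (y + ½) ≡ ⟦ 2 ⟧ * y + 1ℚ
  double = solve-∀ ℚ-ring

theorem2p11 : (m n : ℕ) → m % 2 ≡ 1 →
    (½ * (⟦ 2 ⟧ ^ℚ n)) * (E n ⟦ m ⟧ + Enum n)
      ≡ Σ< m (λ l → ((- ⟦ 1 ⟧) ^ℚ l) * (⟦ 2 ℕ.* l ℕ.+ 1 ⟧ ^ℚ n))
theorem2p11 m n m-odd = begin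
  K * (a m + a 0)
    ≡⟨ cong (K *_) (Σ<-alternating-telescope-odd a m m-odd) ⟨
  K * Σ< m (λ l → (- 1ℚ) ^ℚ l * (a (suc l) + a l))
    ≡⟨ *-distribˡ-Σ< m K _ ⟩
  Σ< m (λ l → K * ((- 1ℚ) ^ℚ l * (a (suc l) + a l)))
    ≡⟨ Σ<-cong m (λ l _ → term l) ⟩
  Σ< m (λ l → (- 1ℚ) ^ℚ l * ⟦ 2 ℕ.* l ℕ.+ 1 ⟧ ^ℚ n)
    ∎
  where
  open ≡-Reasoning
  K : ℚ
  K = ½ * ⟦ 2 ⟧ ^ℚ n
  a : ℕ → ℚ
  a l = E n ⟦ l ⟧
  term : ∀ l → K * ((- 1ℚ) ^ℚ l * (a (suc l) + a l)) ≡ (- 1ℚ) ^ℚ l * ⟦ 2 ℕ.* l ℕ.+ 1 ⟧ ^ℚ n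
  term l = trans (x∙yz≈y∙xz K ((- 1ℚ) ^ℚ l) (a (suc l) + a l))
                 (cong ((- 1ℚ) ^ℚ l *_) (E-shift-ℕ n l))
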